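{- Let $l\in\mathbb{N}$ and $n\in\mathbb{N}_0$. Then \[ \sum_{j=0}^{n}\binom{n}{j}\frac{B_{j+l}}{j+l}=\sum_{k=1}^{l}(-1)^{l-k}\binom{l-1}{l-k}\frac{B_{n+k}(1)-B_0}{n+k}. \]
   Context: The Bernoulli polynomials $B_m(x)$ are defined by $\frac{t}{e^t-1}e^{xt}=\sum_{m\ge0}B_m(x)\frac{t^m}{m!}$, and the Bernoulli numbers are $B_m=B_m(0)$ (so $B_0=1$). -}

module Defs where

open import Data.Nat as ℕ using (ℕ; zero; suc; _∸_)
open import Data.Nat.Combinatorics using (_C_)
open import Data.Integer using (+_)
open import Data.List using (List; []; _∷_; _++_)
open import Data.Rational using (ℚ; 0ℚ; 1ℚ; _+_; _*_; -_; _/_)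

⟦_⟧ : ℕ → ℚ
⟦ n ⟧ = + n / 1

-- 1/d as a rational, with the (unused) convention 1/0 = 0
inv : ℕ → ℚ
inv zero    = 0ℚ
inv (suc d) = + 1 / suc d

_^ℚ_ : ℚ → ℕ → ℚ
x ^ℚ zero  = 1ℚ
x ^ℚ suc m = x * (x ^ℚ m)

sgn : ℕ → ℚ
sgn zero    = 1ℚ
sgn (suc m) = - sgn m

∑ : ℕ → (ℕ → ℚ) → ℚ
∑ zero    f = 0ℚ
∑ (suc n) f = ∑ n f + f n

private
  wsum : ℕ → ℕ → List ℚ → ℚ
  wsum N s []       = 0ℚ
  wsum N s (b ∷ bs) = ⟦ N C s ⟧ * b + wsum N (suc s) bs

  lastOr : ℚ → List ℚ → ℚ
  lastOr d []       = d
  lastOr d (b ∷ bs) = lastOr b bs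

-- bernUpTo m = [B_0, B_1, ..., B_m], computed by the recurrence
--   B_0 = 1,  Σ_{k=0}^{m} C(m+1,k) B_k = 0  (m ≥ 1),
-- which is equivalent to the generating function t/(e^t-1) = Σ B_m t^m/m!.
bernUpTo : ℕ → List ℚ
bernUpTo zero    = 1ℚ ∷ []
bernUpTo (suc m) = bs ++ ((- (inv (suc (suc m)) * wsum (suc (suc m)) 0 bs)) ∷ [])
  where bs = bernUpTo m

bernoulli : ℕ → ℚ
bernoulli m = lastOr 0ℚ (bernUpTo m)

bernoulliPoly : ℕ → ℚ → ℚ
bernoulliPoly m x = ∑ (suc m) (λ k → ⟦ m C k ⟧ * bernoulli k * (x ^ℚ (m ∸ k)))

-- Nothing about Bernoulli numbers is used beyond the definition of B_m(1): the identity holds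
-- for an arbitrary sequence b in place of B. Write T g n = Σ_j C(n,j) g(j) for the binomial
-- transform. Pascal's rule gives T (g ∘ suc) = Δ (T g) for the forward difference Δ, so shifting
-- the sequence by l - 1 turns T into Δ^(l-1) (T g) = Σ_i (-1)^(l-1-i) C(l-1,i) T g (n + i).
-- For g(j) = b(j+1)/(j+1) the absorption identity C(n,j)/(j+1) = C(n+1,j+1)/(n+1) evaluates
-- T g n = (Σ_k C(n+1,k) b_k - b_0)/(n+1), which for b = B is (B_{n+1}(1) - B_0)/(n+1).
module Submission where

open import Defs
open import Data.Nat as ℕ using (ℕ; zero; suc; _≤_; _<_; _∸_) renaming (_+_ to _+ℕ_)
import Data.Nat.Properties as ℕ
open import Data.Nat.Combinatorics using (_C_; nC1≡n; nCk+nC[k+1]≡[n+1]C[k+1]; nCk≡nC[n∸k]; k>n⇒nCk≡0)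
import Data.Integer as ℤ
import Data.Integer.Properties as ℤ
open import Data.Rational using (ℚ; 0ℚ; 1ℚ; _+_; _*_; _-_; -_; toℚᵘ)
open import Data.Rational.Properties
open import Data.Rational.Unnormalised using (mkℚᵘ; *≡*; _≃_)
import Data.Rational.Unnormalised.Properties as ℚᵘ
open import Data.Rational.Solver using (module +-*-Solver)
open +-*-Solver using (solve; _:=_; _:+_; _:*_; :-_; _:-_; con)
open import Function using (_∘_)
open import Relation.Binary.PropositionalEquality
open ≡-Reasoning

toℚᵘ-⟦⟧ : ∀ n → toℚᵘ ⟦ n ⟧ ≃ mkℚᵘ (ℤ.+ n) 0
toℚᵘ-⟦⟧ n = toℚᵘ-fromℚᵘ (mkℚᵘ (ℤ.+ n) 0)

⟦⟧-homo-+ : ∀ m n → ⟦ m +ℕ n ⟧ ≡ ⟦ m ⟧ + ⟦ n ⟧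
⟦⟧-homo-+ m n = toℚᵘ-injective (ℚᵘ.≃-trans (toℚᵘ-⟦⟧ (m +ℕ n)) (ℚᵘ.≃-sym (ℚᵘ.≃-trans
  (toℚᵘ-homo-+ ⟦ m ⟧ ⟦ n ⟧) (ℚᵘ.≃-trans (ℚᵘ.+-cong (toℚᵘ-⟦⟧ m) (toℚᵘ-⟦⟧ n))
    (*≡* (cong (ℤ._* ℤ.+ 1) (trans
      (cong₂ ℤ._+_ (ℤ.*-identityʳ (ℤ.+ m)) (ℤ.*-identityʳ (ℤ.+ n)))
      (sym (ℤ.pos-+ m n)))))))))

⟦⟧-homo-* : ∀ m n → ⟦ m ℕ.* n ⟧ ≡ ⟦ m ⟧ * ⟦ n ⟧
⟦⟧-homo-* m n = toℚᵘ-injective (ℚᵘ.≃-trans (toℚᵘ-⟦⟧ (m ℕ.* n)) (ℚᵘ.≃-sym (ℚᵘ.≃-trans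
  (toℚᵘ-homo-* ⟦ m ⟧ ⟦ n ⟧) (ℚᵘ.≃-trans (ℚᵘ.*-cong (toℚᵘ-⟦⟧ m) (toℚᵘ-⟦⟧ n))
    (*≡* (cong (ℤ._* ℤ.+ 1) (sym (ℤ.pos-* m n))))))))

⟦suc⟧*inv≡1 : ∀ n → ⟦ suc n ⟧ * inv (suc n) ≡ 1ℚ
⟦suc⟧*inv≡1 n = toℚᵘ-injective (ℚᵘ.≃-trans (toℚᵘ-homo-* ⟦ suc n ⟧ (inv (suc n)))
  (ℚᵘ.≃-trans (ℚᵘ.*-cong (toℚᵘ-⟦⟧ (suc n)) (toℚᵘ-fromℚᵘ (mkℚᵘ (ℤ.+ 1) n)))
    (ℚᵘ.*-inverseʳ (mkℚᵘ (ℤ.+ suc n) 0))))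

[k+1]*[n+1]C[k+1]≡[n+1]*nCk : ∀ n k → suc k ℕ.* (suc n C suc k) ≡ suc n ℕ.* (n C k)
[k+1]*[n+1]C[k+1]≡[n+1]*nCk zero    zero    = refl
[k+1]*[n+1]C[k+1]≡[n+1]*nCk zero    (suc k) = ℕ.*-zeroʳ (suc (suc k))
[k+1]*[n+1]C[k+1]≡[n+1]*nCk (suc n) zero    =
  trans (ℕ.*-identityˡ _) (trans (nC1≡n (suc (suc n))) (sym (ℕ.*-identityʳ (suc (suc n)))))
[k+1]*[n+1]C[k+1]≡[n+1]*nCk (suc n) (suc k) = begin
  suc (suc k) ℕ.* (suc (suc n) C suc (suc k))
    ≡⟨ cong (suc (suc k) ℕ.*_) (sym (nCk+nC[k+1]≡[n+1]C[k+1] (suc n) (suc k))) ⟩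
  suc (suc k) ℕ.* (X +ℕ Y)
    ≡⟨ ℕ.*-distribˡ-+ (suc (suc k)) X Y ⟩
  (X +ℕ suc k ℕ.* X) +ℕ suc (suc k) ℕ.* Y
    ≡⟨ cong₂ (λ u v → (X +ℕ u) +ℕ v) ([k+1]*[n+1]C[k+1]≡[n+1]*nCk n k) ([k+1]*[n+1]C[k+1]≡[n+1]*nCk n (suc k)) ⟩
  (X +ℕ suc n ℕ.* (n C k)) +ℕ suc n ℕ.* (n C suc k)
    ≡⟨ ℕ.+-assoc X _ _ ⟩
  X +ℕ (suc n ℕ.* (n C k) +ℕ suc n ℕ.* (n C suc k))
    ≡⟨ cong (X +ℕ_) (sym (ℕ.*-distribˡ-+ (suc n) (n C k) (n C suc k))) ⟩
  X +ℕ suc n ℕ.* (n C k +ℕ n C suc k)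
    ≡⟨ cong (λ u → X +ℕ suc n ℕ.* u) (nCk+nC[k+1]≡[n+1]C[k+1] n k) ⟩
  suc (suc n) ℕ.* X
    ∎
  where
  X = suc n C suc k
  Y = suc n C suc (suc k)

⟦nCk⟧*inv[k+1]≡⟦[n+1]C[k+1]⟧*inv[n+1] :
  ∀ n k → ⟦ n C k ⟧ * inv (suc k) ≡ ⟦ suc n C suc k ⟧ * inv (suc n)
⟦nCk⟧*inv[k+1]≡⟦[n+1]C[k+1]⟧*inv[n+1] n k = begin
  x * u                  ≡⟨ sym (*-identityʳ (x * u)) ⟩
  x * u * 1ℚ             ≡⟨ cong (x * u *_) (sym (⟦suc⟧*inv≡1 n)) ⟩
  x * u * (q * v)        ≡⟨ solve 4 (λ x u q v → x :* u :* (q :* v) := q :* x :* u :* v) refl x u q v ⟩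
  q * x * u * v          ≡⟨ cong (λ t → t * u * v) absorption ⟩
  p * y * u * v          ≡⟨ solve 4 (λ p y u v → p :* y :* u :* v := y :* v :* (p :* u)) refl p y u v ⟩
  y * v * (p * u)        ≡⟨ cong (y * v *_) (⟦suc⟧*inv≡1 k) ⟩
  y * v * 1ℚ             ≡⟨ *-identityʳ (y * v) ⟩
  y * v                  ∎
  where
  x = ⟦ n C k ⟧
  y = ⟦ suc n C suc k ⟧
  p = ⟦ suc k ⟧
  q = ⟦ suc n ⟧
  u = inv (suc k)
  v = inv (suc n)
  absorption : q * x ≡ p * y
  absorption = begin
    q * x                     ≡⟨ sym (⟦⟧-homo-* (suc n) (n C k)) ⟩
    ⟦ suc n ℕ.* (n C k) ⟧     ≡⟨ cong ⟦_⟧ (sym ([k+1]*[n+1]C[k+1]≡[n+1]*nCk n k)) ⟩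
    ⟦ suc k ℕ.* (suc n C suc k) ⟧ ≡⟨ ⟦⟧-homo-* (suc k) (suc n C suc k) ⟩
    p * y                     ∎

∑-cong : ∀ n {f g : ℕ → ℚ} → (∀ i → i < n → f i ≡ g i) → ∑ n f ≡ ∑ n g
∑-cong zero    f≡g = refl
∑-cong (suc n) f≡g = cong₂ _+_ (∑-cong n (λ i i<n → f≡g i (ℕ.m<n⇒m<1+n i<n))) (f≡g n (ℕ.n<1+n n))

∑-unconsˡ : ∀ n f → ∑ (suc n) f ≡ f 0 + ∑ n (f ∘ suc)
∑-unconsˡ zero    f = trans (+-identityˡ (f 0)) (sym (+-identityʳ (f 0)))
∑-unconsˡ (suc n) f = trans (cong (_+ f (suc n)) (∑-unconsˡ n f)) (+-assoc (f 0) _ _)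

∑-distrib-+ : ∀ n f g → ∑ n (λ i → f i + g i) ≡ ∑ n f + ∑ n g
∑-distrib-+ zero    f g = sym (+-identityʳ 0ℚ)
∑-distrib-+ (suc n) f g = trans (cong (_+ (f n + g n)) (∑-distrib-+ n f g))
  (solve 4 (λ a b c d → (a :+ b) :+ (c :+ d) := (a :+ c) :+ (b :+ d)) refl (∑ n f) (∑ n g) (f n) (g n))

∑-neg : ∀ n f → ∑ n (λ i → - f i) ≡ - ∑ n f
∑-neg zero    f = refl
∑-neg (suc n) f = trans (cong (_+ (- f n)) (∑-neg n f)) (sym (neg-distrib-+ (∑ n f) (f n)))

∑-distribʳ-* : ∀ n f c → ∑ n (λ i → f i * c) ≡ ∑ n f * c
∑-distribʳ-* zero    f c = sym (*-zeroˡ c)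
∑-distribʳ-* (suc n) f c = trans (cong (_+ (f n * c)) (∑-distribʳ-* n f c)) (sym (*-distribʳ-+ c (∑ n f) (f n)))

binomialTransform : (ℕ → ℚ) → ℕ → ℚ
binomialTransform g n = ∑ (suc n) (λ j → ⟦ n C j ⟧ * g j)

binomialTransform-cong : ∀ {g h} → (∀ j → g j ≡ h j) → ∀ n → binomialTransform g n ≡ binomialTransform h n
binomialTransform-cong g≡h n = ∑-cong (suc n) (λ j _ → cong (⟦ n C j ⟧ *_) (g≡h j))

binomialTransform-suc : ∀ g n →
  binomialTransform g (suc n) ≡ binomialTransform g n + binomialTransform (g ∘ suc) n
binomialTransform-suc g n = begin
  binomialTransform g (suc n)
    ≡⟨ ∑-unconsˡ (suc n) _ ⟩
  1ℚ * g 0 + ∑ (suc n) (λ j → ⟦ suc n C suc j ⟧ * g (suc j))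
    ≡⟨ cong ((1ℚ * g 0) +_) (∑-cong (suc n) (λ j _ → pascal j)) ⟩
  1ℚ * g 0 + ∑ (suc n) (λ j → ⟦ n C j ⟧ * g (suc j) + ⟦ n C suc j ⟧ * g (suc j))
    ≡⟨ cong ((1ℚ * g 0) +_) (∑-distrib-+ (suc n) _ _) ⟩
  1ℚ * g 0 + (binomialTransform (g ∘ suc) n + (Q + ⟦ n C suc n ⟧ * g (suc n)))
    ≡⟨ cong (λ t → 1ℚ * g 0 + (binomialTransform (g ∘ suc) n + (Q + t * g (suc n))))
            (cong ⟦_⟧ (k>n⇒nCk≡0 (ℕ.n<1+n n))) ⟩
  1ℚ * g 0 + (binomialTransform (g ∘ suc) n + (Q + 0ℚ * g (suc n)))
    ≡⟨ solve 4 (λ a t q b → a :+ (t :+ (q :+ con 0ℚ :* b)) := (a :+ q) :+ t) refl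
             (1ℚ * g 0) (binomialTransform (g ∘ suc) n) Q (g (suc n)) ⟩
  (1ℚ * g 0 + Q) + binomialTransform (g ∘ suc) n
    ≡⟨ cong (_+ binomialTransform (g ∘ suc) n) (sym (∑-unconsˡ n _)) ⟩
  binomialTransform g n + binomialTransform (g ∘ suc) n
    ∎
  where
  Q = ∑ n (λ j → ⟦ n C suc j ⟧ * g (suc j))
  pascal : ∀ j → ⟦ suc n C suc j ⟧ * g (suc j) ≡ ⟦ n C j ⟧ * g (suc j) + ⟦ n C suc j ⟧ * g (suc j)
  pascal j = trans (cong (λ t → ⟦ t ⟧ * g (suc j)) (sym (nCk+nC[k+1]≡[n+1]C[k+1] n j)))
    (trans (cong (_* g (suc j)) (⟦⟧-homo-+ (n C j) (n C suc j))) (*-distribʳ-+ (g (suc j)) ⟦ n C j ⟧ ⟦ n C suc j ⟧))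

Δ-binomialTransform : ∀ g n →
  binomialTransform (g ∘ suc) n ≡ binomialTransform g (suc n) - binomialTransform g n
Δ-binomialTransform g n = begin
  T′                ≡⟨ solve 2 (λ t t′ → t′ := t :+ t′ :- t) refl T T′ ⟩
  T + T′ - T        ≡⟨ cong (_- T) (sym (binomialTransform-suc g n)) ⟩
  binomialTransform g (suc n) - T ∎
  where
  T  = binomialTransform g n
  T′ = binomialTransform (g ∘ suc) n

iteratedDifference : ℕ → (ℕ → ℚ) → ℕ → ℚ
iteratedDifference m f n = binomialTransform (λ i → sgn (m ∸ i) * f (n +ℕ i)) m

iteratedDifference-zero : ∀ f n → iteratedDifference 0 f n ≡ f n
iteratedDifference-zero f n = begin
  0ℚ + 1ℚ * (1ℚ * f (n +ℕ 0)) ≡⟨ solve 1 (λ x → con 0ℚ :+ con 1ℚ :* (con 1ℚ :* x) := x) refl (f (n +ℕ 0)) ⟩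
  f (n +ℕ 0)                   ≡⟨ cong f (ℕ.+-identityʳ n) ⟩
  f n                          ∎

iteratedDifference-suc : ∀ m f n →
  iteratedDifference (suc m) f n ≡ iteratedDifference m f (suc n) - iteratedDifference m f n
iteratedDifference-suc m f n = begin
  iteratedDifference (suc m) f n
    ≡⟨ binomialTransform-suc h m ⟩
  binomialTransform h m + binomialTransform (h ∘ suc) m
    ≡⟨ cong₂ _+_ lowerTerms (binomialTransform-cong (λ i → cong (λ t → sgn (m ∸ i) * f t) (ℕ.+-suc n i)) m) ⟩
  - iteratedDifference m f n + iteratedDifference m f (suc n)
    ≡⟨ +-comm (- iteratedDifference m f n) (iteratedDifference m f (suc n)) ⟩
  iteratedDifference m f (suc n) - iteratedDifference m f n
    ∎
  where
  h : ℕ → ℚ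
  h i = sgn (suc m ∸ i) * f (n +ℕ i)
  lowerTerms : binomialTransform h m ≡ - iteratedDifference m f n
  lowerTerms = trans (∑-cong (suc m) (λ i i≤m → begin
      ⟦ m C i ⟧ * (sgn (suc m ∸ i) * f (n +ℕ i))
        ≡⟨ cong (λ t → ⟦ m C i ⟧ * (sgn t * f (n +ℕ i))) (ℕ.+-∸-assoc 1 (ℕ.≤-pred i≤m)) ⟩
      ⟦ m C i ⟧ * (- sgn (m ∸ i) * f (n +ℕ i))
        ≡⟨ solve 3 (λ c s x → c :* (:- s :* x) := :- (c :* (s :* x))) refl ⟦ m C i ⟧ (sgn (m ∸ i)) (f (n +ℕ i)) ⟩
      - (⟦ m C i ⟧ * (sgn (m ∸ i) * f (n +ℕ i)))
        ∎))
    (∑-neg (suc m) _)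

binomialTransform-shift : ∀ m g n →
  binomialTransform (λ j → g (j +ℕ m)) n ≡ iteratedDifference m (binomialTransform g) n
binomialTransform-shift zero g n = begin
  binomialTransform (λ j → g (j +ℕ 0)) n ≡⟨ binomialTransform-cong (λ j → cong g (ℕ.+-identityʳ j)) n ⟩
  binomialTransform g n                  ≡⟨ sym (iteratedDifference-zero (binomialTransform g) n) ⟩
  iteratedDifference 0 (binomialTransform g) n ∎
binomialTransform-shift (suc m) g n = begin
  binomialTransform (λ j → g (j +ℕ suc m)) n
    ≡⟨ binomialTransform-cong (λ j → cong g (ℕ.+-suc j m)) n ⟩
  binomialTransform (G ∘ suc) n
    ≡⟨ Δ-binomialTransform G n ⟩
  binomialTransform G (suc n) - binomialTransform G n
    ≡⟨ cong₂ _-_ (binomialTransform-shift m g (suc n)) (binomialTransform-shift m g n) ⟩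
  iteratedDifference m (binomialTransform g) (suc n) - iteratedDifference m (binomialTransform g) n
    ≡⟨ sym (iteratedDifference-suc m (binomialTransform g) n) ⟩
  iteratedDifference (suc m) (binomialTransform g) n
    ∎
  where
  G : ℕ → ℚ
  G j = g (j +ℕ m)

binomialTransform-divided : ∀ b n →
  binomialTransform (λ j → b (suc j) * inv (suc j)) n ≡ (binomialTransform b (suc n) - b 0) * inv (suc n)
binomialTransform-divided b n = begin
  binomialTransform (λ j → b (suc j) * inv (suc j)) n
    ≡⟨ ∑-cong (suc n) (λ j _ → absorb j) ⟩
  ∑ (suc n) (λ j → ⟦ suc n C suc j ⟧ * b (suc j) * inv (suc n))
    ≡⟨ ∑-distribʳ-* (suc n) _ (inv (suc n)) ⟩
  S * inv (suc n)
    ≡⟨ cong (_* inv (suc n)) (solve 2 (λ s b₀ → s := con 1ℚ :* b₀ :+ s :- b₀) refl S (b 0)) ⟩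
  (1ℚ * b 0 + S - b 0) * inv (suc n)
    ≡⟨ cong (λ t → (t - b 0) * inv (suc n)) (sym (∑-unconsˡ (suc n) _)) ⟩
  (binomialTransform b (suc n) - b 0) * inv (suc n)
    ∎
  where
  S = ∑ (suc n) (λ j → ⟦ suc n C suc j ⟧ * b (suc j))
  absorb : ∀ j → ⟦ n C j ⟧ * (b (suc j) * inv (suc j)) ≡ ⟦ suc n C suc j ⟧ * b (suc j) * inv (suc n)
  absorb j = begin
    ⟦ n C j ⟧ * (b (suc j) * inv (suc j))
      ≡⟨ solve 3 (λ c x u → c :* (x :* u) := c :* u :* x) refl ⟦ n C j ⟧ (b (suc j)) (inv (suc j)) ⟩
    ⟦ n C j ⟧ * inv (suc j) * b (suc j)
      ≡⟨ cong (_* b (suc j)) (⟦nCk⟧*inv[k+1]≡⟦[n+1]C[k+1]⟧*inv[n+1] n j) ⟩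
    ⟦ suc n C suc j ⟧ * inv (suc n) * b (suc j)
      ≡⟨ solve 3 (λ c v x → c :* v :* x := c :* x :* v) refl ⟦ suc n C suc j ⟧ (inv (suc n)) (b (suc j)) ⟩
    ⟦ suc n C suc j ⟧ * b (suc j) * inv (suc n)
      ∎

1^ℚn≡1 : ∀ n → 1ℚ ^ℚ n ≡ 1ℚ
1^ℚn≡1 zero    = refl
1^ℚn≡1 (suc n) = trans (*-identityˡ (1ℚ ^ℚ n)) (1^ℚn≡1 n)

bernoulliPoly-1 : ∀ m → bernoulliPoly m 1ℚ ≡ binomialTransform bernoulli m
bernoulliPoly-1 m = ∑-cong (suc m) (λ k _ → begin
  ⟦ m C k ⟧ * bernoulli k * (1ℚ ^ℚ (m ∸ k)) ≡⟨ cong (⟦ m C k ⟧ * bernoulli k *_) (1^ℚn≡1 (m ∸ k)) ⟩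
  ⟦ m C k ⟧ * bernoulli k * 1ℚ              ≡⟨ *-identityʳ _ ⟩
  ⟦ m C k ⟧ * bernoulli k                   ∎)

mainTheorem20 : (l n : ℕ) → 1 ≤ l →
    ∑ (suc n) (λ j → ⟦ n C j ⟧ * (bernoulli (j +ℕ l) * inv (j +ℕ l)))
      ≡ ∑ l (λ i → sgn (l ∸ suc i) * ⟦ (l ∸ 1) C (l ∸ suc i) ⟧
                   * ((bernoulliPoly (n +ℕ suc i) 1ℚ - bernoulli 0) * inv (n +ℕ suc i)))
mainTheorem20 zero    n ()
mainTheorem20 (suc m) n _ = begin
  ∑ (suc n) (λ j → ⟦ n C j ⟧ * (bernoulli (j +ℕ suc m) * inv (j +ℕ suc m)))
    ≡⟨ binomialTransform-cong (λ j → cong (λ t → bernoulli t * inv t) (ℕ.+-suc j m)) n ⟩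
  binomialTransform (λ j → a (j +ℕ m)) n
    ≡⟨ binomialTransform-shift m a n ⟩
  iteratedDifference m (binomialTransform a) n
    ≡⟨ ∑-cong (suc m) (λ i i<1+m → term i (ℕ.≤-pred i<1+m)) ⟩
  ∑ (suc m) (λ i → sgn (m ∸ i) * ⟦ m C (m ∸ i) ⟧ * c (n +ℕ suc i))
    ∎
  where
  a : ℕ → ℚ
  a k = bernoulli (suc k) * inv (suc k)
  c : ℕ → ℚ
  c k = (bernoulliPoly k 1ℚ - bernoulli 0) * inv k
  term : ∀ i → i ≤ m →
    ⟦ m C i ⟧ * (sgn (m ∸ i) * binomialTransform a (n +ℕ i)) ≡ sgn (m ∸ i) * ⟦ m C (m ∸ i) ⟧ * c (n +ℕ suc i)
  term i i≤m = begin
    ⟦ m C i ⟧ * (sgn (m ∸ i) * binomialTransform a (n +ℕ i))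
      ≡⟨ cong (λ k → ⟦ k ⟧ * (sgn (m ∸ i) * binomialTransform a (n +ℕ i))) (nCk≡nC[n∸k] i≤m) ⟩
    ⟦ m C (m ∸ i) ⟧ * (sgn (m ∸ i) * binomialTransform a (n +ℕ i))
      ≡⟨ cong (λ t → ⟦ m C (m ∸ i) ⟧ * (sgn (m ∸ i) * t)) bernoulliTerm ⟩
    ⟦ m C (m ∸ i) ⟧ * (sgn (m ∸ i) * c (n +ℕ suc i))
      ≡⟨ solve 3 (λ x s y → x :* (s :* y) := s :* x :* y) refl ⟦ m C (m ∸ i) ⟧ (sgn (m ∸ i)) (c (n +ℕ suc i)) ⟩
    sgn (m ∸ i) * ⟦ m C (m ∸ i) ⟧ * c (n +ℕ suc i)
      ∎
    where
    bernoulliTerm : binomialTransform a (n +ℕ i) ≡ c (n +ℕ suc i)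
    bernoulliTerm = begin
      binomialTransform a (n +ℕ i)
        ≡⟨ binomialTransform-divided bernoulli (n +ℕ i) ⟩
      (binomialTransform bernoulli (suc (n +ℕ i)) - bernoulli 0) * inv (suc (n +ℕ i))
        ≡⟨ cong (λ t → (t - bernoulli 0) * inv (suc (n +ℕ i))) (sym (bernoulliPoly-1 (suc (n +ℕ i)))) ⟩
      c (suc (n +ℕ i))
        ≡⟨ cong c (sym (ℕ.+-suc n i)) ⟩
      c (n +ℕ suc i)
        ∎
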